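{- Let $\beta$ be a totally positive quadratic integer with $\operatorname{Tr}\beta > \operatorname{Nm}\beta$. Then there is a constant $c_\beta > 0$ such that $p_\beta((\operatorname{Tr}\beta)\beta^n) \leq c_\beta$ for all $n \in \mathbb{Z}_{\geq 0}$.
   Context: A quadratic integer is a root of a monic irreducible quadratic polynomial over $\mathbb{Z}$. For real quadratic $\beta$ with conjugate $\beta'$, $\operatorname{Tr}\beta = \beta + \beta'$, $\operatorname{Nm}\beta = \beta\beta'$, and $\beta$ is totally positive if $\beta > 0$ and $\beta' > 0$. For $\beta, \alpha \in \mathbb{C}$, $p_\beta(\alpha) \in \mathbb{Z}_{\geq 0}\cup\{\infty\}$ denotes the number of expressions $\alpha = a_j\beta^j + \dots + a_1\beta + a_0$ with $j, a_i \in \mathbb{Z}_{\geq 0}$ and $a_j \neq 0$; equivalently, the number of polynomials $f(x) \in \mathbb{Z}_{\geq 0}[x]$ with $f(\beta) = \alpha$. -}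

module Defs where

open import Data.Integer using (ℤ; +_; _+_; _*_; -_; _-_; _<_)
open import Data.Nat using (ℕ)
open import Data.List using (List; []; _∷_; length)
open import Data.List.Relation.Unary.All using (All)
open import Data.List.Relation.Unary.Unique.Propositional using (Unique)
open import Data.Product using (_×_; _,_)
open import Data.Empty using (⊥)
open import Relation.Binary.PropositionalEquality using (_≡_; _≢_)

-- The quadratic integer β is a root of x² - t·x + m  (t = Tr β, m = Nm β).
-- Elements of ℤ[β] are represented as pairs (a , b) meaning a + b·β,
-- computed with the relation β² = t·β - m.  Since x² - t·x + m is
-- irreducible, this representation is faithful (ℤ[β] ≅ ℤ[x]/(x² - t x + m)).
ZB : Set
ZB = ℤ × ℤ

_⊕_ : ZB → ZB → ZB
(a , b) ⊕ (c , d) = (a + c , b + d)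

-- multiplication by β:  β (x + yβ) = -m y + (x + t y) β
mulβ : (t m : ℤ) → ZB → ZB
mulβ t m (x , y) = (- (m * y) , x + t * y)

powβ : (t m : ℤ) → ℕ → ZB
powβ t m ℕ.zero = (+ 1 , + 0)
powβ t m (ℕ.suc n) = mulβ t m (powβ t m n)

scale : ℤ → ZB → ZB
scale k (x , y) = (k * x , k * y)

-- A polynomial f ∈ ℤ≥0[x] is a coefficient list [a₀, a₁, …, a_j];
-- evaluation at β by Horner's rule.
evalβ : (t m : ℤ) → List ℕ → ZB
evalβ t m [] = (+ 0 , + 0)
evalβ t m (a ∷ as) = (+ a , + 0) ⊕ mulβ t m (evalβ t m as)

-- Expressions a_j β^j + … + a₀ with a_j ≠ 0: non-empty coefficient list
-- whose last (leading) coefficient is nonzero.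
LeadingNonzero : List ℕ → Set
LeadingNonzero [] = ⊥
LeadingNonzero (a ∷ []) = a ≢ 0
LeadingNonzero (a ∷ b ∷ as) = LeadingNonzero (b ∷ as)

IsExpansion : (t m : ℤ) → ZB → List ℕ → Set
IsExpansion t m α f = LeadingNonzero f × evalβ t m f ≡ α

-- p_β(α) ≤ c : every finite family of pairwise distinct expansions of α
-- has at most c members (in particular p_β(α) is finite).
pβ≤ : (t m : ℤ) → ZB → ℕ → Set
pβ≤ t m α c = (fs : List (List ℕ)) → Unique fs → All (IsExpansion t m α) fs → length fs Data.Nat.≤ c

-- x² - t x + m is irreducible over ℤ (equivalently ℚ): discriminant not a square
Irreducible : (t m : ℤ) → Set
Irreducible t m = (k : ℤ) → k * k ≢ t * t - + 4 * m

-- both roots of x² - t x + m are real and positive: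
-- discriminant > 0, sum of roots t > 0, product of roots m > 0
TotallyPositive : (t m : ℤ) → Set
TotallyPositive t m = (+ 0 < t * t - + 4 * m) × (+ 0 < t) × (+ 0 < m)

-- Write x + yβ as P − Qβ′, where β′ = t − β is the conjugate, so P = x + ty and Q = y. If an
-- expansion a₀ + a₁β + ⋯ has value with coordinates (P, Q), its tail a₁ + a₂β + ⋯ has coordinates
-- (Q, Q′) with mQ′ = a₀ + tQ − P. Since t ≥ m + 2 (for t = m + 1 the polynomial x² − tx + m is
-- (x − 1)(x − m)), reading an expansion from its end shows 0 ≤ 2Q ≤ P and that P bounds both its
-- length and its digits.
-- For an expansion of cβⁿ, follow instead the coordinates (p, q) of the k-th tail minus cβⁿ⁻ᵏ. They
-- stay (0, 0) while the digits are 0; after the first nonzero digit 0 ≤ p < q holds, q strictly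
-- increases from tail to tail and q + (n − k) < c. Hence every expansion of cβⁿ consists of n ∸ c
-- zeros followed by a word of length at most 3c with digits at most (m + 2)c. The theorem is the
-- case c = t.

{-# OPTIONS --safe #-}
module Submission where

open import Defs
open import Data.Integer using (ℤ; _<_)
open import Data.Nat using (ℕ)
open import Data.Product using (Σ; _×_)

open import Data.Empty using (⊥-elim)
open import Data.Fin using (Fin; zero; suc)
open import Data.Fin.Properties using (injective⇒≤)
open import Data.Integer using (+_; -[1+_]; _+_; _*_; -_; _-_; _≤_; +≤+; +<+; nonNegative)
import Data.Integer.Properties as ℤP
open import Data.Integer.Tactic.RingSolver using (solve)
open import Data.List using (List; []; _∷_; [_]; _++_; length; lookup; map; replicate; upTo; cartesianProductWith)
open import Data.List.Membership.Propositional using (_∈_)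
open import Data.List.Membership.Propositional.Properties using (∈-lookup; ∈-map⁺; ∈-cartesianProductWith⁺; ∈-applyUpTo⁺)
open import Data.List.Properties using (length-map)
open import Data.List.Relation.Unary.All as All using (All)
import Data.List.Relation.Unary.AllPairs as AllPairs
open import Data.List.Relation.Unary.Any as Any using (here; there)
open import Data.List.Relation.Unary.Any.Properties using (lookup-index)
open import Data.List.Relation.Unary.Unique.Propositional using (Unique)
open import Data.Nat as ℕ using (zero; suc; _∸_; z≤n; s≤s)
import Data.Nat.Properties as ℕP
open import Data.Product using (_,_; proj₁; proj₂; ∃)
open import Data.Sum using (inj₁; inj₂)
open import Data.Unit using (⊤; tt)
open import Function using (id; _∘_)
open import Relation.Binary.PropositionalEquality
  using (_≡_; refl; sym; trans; cong; cong₂; subst; subst₂; module ≡-Reasoning)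
open import Relation.Nullary using (¬_; yes; no)

module _ {A : Set} where

  Unique-lookup-injective : ∀ {xs : List A} → Unique xs → ∀ i j → lookup xs i ≡ lookup xs j → i ≡ j
  Unique-lookup-injective (_  AllPairs.∷ _) zero    zero    _  = refl
  Unique-lookup-injective (x∉ AllPairs.∷ _) zero    (suc j) eq = ⊥-elim (All.lookup x∉ (∈-lookup j) eq)
  Unique-lookup-injective (x∉ AllPairs.∷ _) (suc i) zero    eq = ⊥-elim (All.lookup x∉ (∈-lookup i) (sym eq))
  Unique-lookup-injective (_  AllPairs.∷ u) (suc i) (suc j) eq = cong suc (Unique-lookup-injective u i j eq)

  Unique⇒length≤ : ∀ {xs ys : List A} → Unique xs → All (_∈ ys) xs → length xs ℕ.≤ length ys
  Unique⇒length≤ {xs} {ys} u xs⊆ys = injective⇒≤ position-injective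
    where
    position : Fin (length xs) → Fin (length ys)
    position i = Any.index (All.lookup xs⊆ys (∈-lookup i))

    position-injective : ∀ {i j} → position i ≡ position j → i ≡ j
    position-injective {i} {j} eq = Unique-lookup-injective u i j (begin
      lookup xs i            ≡⟨ lookup-index (All.lookup xs⊆ys (∈-lookup i)) ⟩
      lookup ys (position i) ≡⟨ cong (lookup ys) eq ⟩
      lookup ys (position j) ≡⟨ lookup-index (All.lookup xs⊆ys (∈-lookup j)) ⟨
      lookup xs j            ∎)
      where open ≡-Reasoning

boundedLists : ℕ → ℕ → List (List ℕ)
boundedLists zero    b = [ [] ]
boundedLists (suc w) b = [] ∷ cartesianProductWith _∷_ (upTo (suc b)) (boundedLists w b)

boundedLists-nonempty : ∀ w b → 0 ℕ.< length (boundedLists w b)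
boundedLists-nonempty zero    b = s≤s z≤n
boundedLists-nonempty (suc w) b = s≤s z≤n

∈-boundedLists : ∀ {w b} {as : List ℕ} → length as ℕ.≤ w → All (ℕ._≤ b) as → as ∈ boundedLists w b
∈-boundedLists {zero}  {as = []}     _            _            = here refl
∈-boundedLists {suc w} {as = []}     _            _            = here refl
∈-boundedLists {suc w} {as = a ∷ as} (s≤s len≤w) (a≤b All.∷ as≤b) =
  there (∈-cartesianProductWith⁺ _∷_ (∈-applyUpTo⁺ id (s≤s a≤b)) (∈-boundedLists len≤w as≤b))

-- Unlike LeadingNonzero, this admits the empty list, so it is closed under tails.
Trimmed : List ℕ → Set
Trimmed []       = ⊤
Trimmed (a ∷ as) = LeadingNonzero (a ∷ as)

LeadingNonzero⇒Trimmed : ∀ {as} → LeadingNonzero as → Trimmed as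
LeadingNonzero⇒Trimmed {_ ∷ _} ln = ln

Trimmed-tail : ∀ {a as} → Trimmed (a ∷ as) → Trimmed as
Trimmed-tail {as = []}    _  = tt
Trimmed-tail {as = _ ∷ _} tr = tr

LeadingNonzero-tail : ∀ {as} → LeadingNonzero (0 ∷ as) → LeadingNonzero as
LeadingNonzero-tail {[]}    0≢0 = ⊥-elim (0≢0 refl)
LeadingNonzero-tail {_ ∷ _} ln  = ln

Trimmed-cons⇒0<a+length : ∀ {a as} → Trimmed (a ∷ as) → 0 ℕ.< a ℕ.+ length as
Trimmed-cons⇒0<a+length {zero}  {[]}     a≢0 = ⊥-elim (a≢0 refl)
Trimmed-cons⇒0<a+length {suc a} {[]}     _   = s≤s z≤n
Trimmed-cons⇒0<a+length {a}     {_ ∷ as} _   = ℕP.≤-trans (s≤s z≤n) (ℕP.m≤n+m (suc (length as)) a)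

i≤i+nonNeg : ∀ i {j} → + 0 ≤ j → i ≤ i + j
i≤i+nonNeg i {j} 0≤j = ℤP.i≤i+j i j {{nonNegative 0≤j}}

≤-by-gap : ∀ {i j d} → + 0 ≤ d → i + d ≡ j → i ≤ j
≤-by-gap {i} 0≤d i+d≡j = subst (i ≤_) i+d≡j (i≤i+nonNeg i 0≤d)

*-nonNeg : ∀ {i j} → + 0 ≤ i → + 0 ≤ j → + 0 ≤ i * j
*-nonNeg {i} {j} 0≤i 0≤j = subst (_≤ i * j) (ℤP.*-zeroʳ i) (ℤP.*-monoˡ-≤-nonNeg i {{nonNegative 0≤i}} 0≤j)

module Expansions (t m : ℤ) (1≤m : + 1 ≤ m) (2+m≤t : + 2 + m ≤ t) where

  open ℤP.≤-Reasoning

  0≤m : + 0 ≤ m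
  0≤m = ℤP.≤-trans (+≤+ z≤n) 1≤m

  0≤t-[2+m] : + 0 ≤ t - (+ 2 + m)
  0≤t-[2+m] = ℤP.i≤j⇒0≤j-i 2+m≤t

  E : List ℕ → ZB
  E = evalβ t m

  P Q : ZB → ℤ
  P (x , y) = x + t * y
  Q (x , y) = y

  P-mulβ : ∀ α → P (mulβ t m α) ≡ t * P α - m * Q α
  P-mulβ (x , y) = ℤP.+-comm (- (m * y)) (t * (x + t * y))

  P-scale : ∀ k α → P (scale k α) ≡ k * P α
  P-scale k (x , y) = distrib
    where
    distrib : k * x + t * (k * y) ≡ k * (x + t * y)
    distrib = solve (k ∷ x ∷ y ∷ t ∷ [])

  P-one : P (+ 1 , + 0) ≡ + 1
  P-one = cong (_+_ (+ 1)) (ℤP.*-zeroʳ t)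

  P-[] : P (E []) ≡ + 0
  P-[] = cong (_+_ (+ 0)) (ℤP.*-zeroʳ t)

  P-cons : ∀ a as → P (E (a ∷ as)) ≡ + a + t * P (E as) - m * Q (E as)
  P-cons a as = regroup (+ a) (proj₁ (E as)) (proj₂ (E as))
    where
    regroup : ∀ a x y → a + - (m * y) + t * (+ 0 + (x + t * y)) ≡ a + t * (x + t * y) - m * y
    regroup a x y = solve (a ∷ x ∷ y ∷ t ∷ m ∷ [])

  Q-cons : ∀ a as → Q (E (a ∷ as)) ≡ P (E as)
  Q-cons a as = ℤP.+-identityˡ (P (E as))

  2Q≤P⇒2P≤tP-mQ : ∀ {P Q} → + 0 ≤ Q → Q + Q ≤ P → P + P ≤ t * P - m * Q
  2Q≤P⇒2P≤tP-mQ {P} {Q} 0≤Q 2Q≤P = ≤-by-gap 0≤gap (solve (P ∷ Q ∷ t ∷ m ∷ []))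
    where
    0≤P : + 0 ≤ P
    0≤P = ℤP.≤-trans (ℤP.+-mono-≤ 0≤Q 0≤Q) 2Q≤P
    0≤P-Q : + 0 ≤ P - Q
    0≤P-Q = ℤP.i≤j⇒0≤j-i (ℤP.≤-trans (i≤i+nonNeg Q 0≤Q) 2Q≤P)
    0≤gap : + 0 ≤ (t - (+ 2 + m)) * P + m * (P - Q)
    0≤gap = ℤP.+-mono-≤ (*-nonNeg 0≤t-[2+m] 0≤P) (*-nonNeg 0≤m 0≤P-Q)

  powβ-0≤2Q≤P : ∀ j → + 0 ≤ Q (powβ t m j) × Q (powβ t m j) + Q (powβ t m j) ≤ P (powβ t m j)
  powβ-0≤2Q≤P zero    = ℤP.≤-refl , ℤP.≤-trans (+≤+ z≤n) (ℤP.≤-reflexive (sym P-one))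
  powβ-0≤2Q≤P (suc j) with powβ-0≤2Q≤P j
  ... | 0≤Q , 2Q≤P =
    ℤP.≤-trans (ℤP.+-mono-≤ 0≤Q 0≤Q) 2Q≤P ,
    subst (P (powβ t m j) + P (powβ t m j) ≤_) (sym (P-mulβ (powβ t m j))) (2Q≤P⇒2P≤tP-mQ 0≤Q 2Q≤P)

  Bounded : ℤ → ℤ → List ℕ → Set
  Bounded P Q as = + 0 ≤ Q × Q + Q ≤ P × + length as ≤ P × All (λ a → + a ≤ P) as

  Bounded-cons : ∀ {a as P Q} → + 1 ≤ + a + + length as →
                 Bounded P Q as → Bounded (+ a + t * P - m * Q) P (a ∷ as)
  Bounded-cons {a} {as} {P} {Q} 1≤a+l (0≤Q , 2Q≤P , l≤P , as≤P) =
    0≤P , 2P≤P′ , 1+l≤P′ , a≤P′ All.∷ All.map (λ b≤P → ℤP.≤-trans b≤P P≤P′) as≤P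
    where
    P′ : ℤ
    P′ = + a + t * P - m * Q
    0≤P : + 0 ≤ P
    0≤P = ℤP.≤-trans (ℤP.+-mono-≤ 0≤Q 0≤Q) 2Q≤P
    a+2P≤P′ : + a + (P + P) ≤ P′
    a+2P≤P′ = begin
      + a + (P + P)          ≤⟨ ℤP.+-monoʳ-≤ (+ a) (2Q≤P⇒2P≤tP-mQ 0≤Q 2Q≤P) ⟩
      + a + (t * P - m * Q)  ≡⟨ ℤP.+-assoc (+ a) (t * P) (- (m * Q)) ⟨
      P′                     ∎
    2P≤P′ : P + P ≤ P′
    2P≤P′ = ℤP.≤-trans (ℤP.i≤j+i (P + P) (+ a)) a+2P≤P′
    P≤P′ : P ≤ P′
    P≤P′ = ℤP.≤-trans (i≤i+nonNeg P 0≤P) 2P≤P′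
    a≤P′ : + a ≤ P′
    a≤P′ = ℤP.≤-trans (i≤i+nonNeg (+ a) (ℤP.+-mono-≤ 0≤P 0≤P)) a+2P≤P′
    1+l≤P′ : + 1 + + length as ≤ P′
    1+l≤P′ = begin
      + 1 + + length as  ≤⟨ ℤP.+-monoʳ-≤ (+ 1) l≤P ⟩
      + 1 + P            ≤⟨ ℤP.+-monoˡ-≤ P (ℤP.≤-trans 1≤a+l (ℤP.+-monoʳ-≤ (+ a) l≤P)) ⟩
      + a + P + P        ≡⟨ ℤP.+-assoc (+ a) P P ⟩
      + a + (P + P)      ≤⟨ a+2P≤P′ ⟩
      P′                 ∎

  Trimmed⇒Bounded : ∀ as → Trimmed as → Bounded (P (E as)) (Q (E as)) as
  Trimmed⇒Bounded []       _  = ℤP.≤-refl , 0≤P[] , 0≤P[] , All.[]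
    where
    0≤P[] : + 0 ≤ P (E [])
    0≤P[] = ℤP.≤-reflexive (sym P-[])
  Trimmed⇒Bounded (a ∷ as) tr =
    subst₂ (λ P′ Q′ → Bounded P′ Q′ (a ∷ as)) (sym (P-cons a as)) (sym (Q-cons a as))
      (Bounded-cons (+≤+ (Trimmed-cons⇒0<a+length {a} {as} tr))
                    (Trimmed⇒Bounded as (Trimmed-tail {a} {as} tr)))

  digit-step-≤m*q′ : ∀ {a p′ q′} → + 0 ≤ p′ → a + t * p′ - m * q′ ≤ p′ → a ≤ m * q′
  digit-step-≤m*q′ {a} {p′} {q′} 0≤p′ a+tp′-mq′≤p′ = ≤-by-gap 0≤gap (solve (a ∷ p′ ∷ q′ ∷ t ∷ m ∷ []))
    where
    0≤gap : + 0 ≤ (t - (+ 2 + m)) * p′ + m * p′ + p′ + (p′ - (a + t * p′ - m * q′))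
    0≤gap = ℤP.+-mono-≤ (ℤP.+-mono-≤ (ℤP.+-mono-≤ (*-nonNeg 0≤t-[2+m] 0≤p′) (*-nonNeg 0≤m 0≤p′)) 0≤p′)
                        (ℤP.i≤j⇒0≤j-i a+tp′-mq′≤p′)

  digit-step-p′<q′ : ∀ {a p′ q′} → + 0 ≤ p′ → a + t * p′ - m * q′ ≤ p′ → + 1 ≤ a + p′ → p′ < q′
  digit-step-p′<q′ {a} {p′} {q′} 0≤p′ a+tp′-mq′≤p′ 1≤a+p′ =
    ℤP.*-cancelˡ-<-nonNeg m {{nonNegative 0≤m}} (ℤP.suc[i]≤j⇒i<j (begin
      + 1 + m * p′     ≤⟨ ℤP.+-monoˡ-≤ (m * p′) 1≤a+p′ ⟩
      a + p′ + m * p′  ≤⟨ ≤-by-gap 0≤gap (solve (a ∷ p′ ∷ q′ ∷ t ∷ m ∷ [])) ⟩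
      m * q′           ∎))
    where
    0≤gap : + 0 ≤ (t - (+ 2 + m)) * p′ + (p′ - (a + t * p′ - m * q′))
    0≤gap = ℤP.+-mono-≤ (*-nonNeg 0≤t-[2+m] 0≤p′) (ℤP.i≤j⇒0≤j-i a+tp′-mq′≤p′)

  m*q≡0⇒q≡0 : ∀ {q} → m * q ≡ + 0 → q ≡ + 0
  m*q≡0⇒q≡0 mq≡0 with ℤP.i*j≡0⇒i≡0∨j≡0 m mq≡0
  ... | inj₁ refl = ⊥-elim (ℤP.<-irrefl refl (ℤP.suc[i]≤j⇒i<j 1≤m))
  ... | inj₂ q≡0  = q≡0

  module Multiples (c : ℤ) (0≤c : + 0 ≤ c) where

    p q : ℕ → List ℕ → ℤ
    p j as = P (E as) - c * P (powβ t m j)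
    q j as = Q (E as) - c * Q (powβ t m j)

    p-zero : ∀ as → p 0 as ≡ P (E as) - c
    p-zero as = drop-β⁰ (P (E as))
      where
      drop-β⁰ : ∀ x → x - c * (+ 1 + t * + 0) ≡ x - c
      drop-β⁰ x = solve (x ∷ c ∷ t ∷ [])

    q-zero : ∀ as → q 0 as ≡ Q (E as)
    q-zero as = drop-β⁰ (Q (E as))
      where
      drop-β⁰ : ∀ y → y - c * + 0 ≡ y
      drop-β⁰ y = solve (y ∷ c ∷ [])

    p-cons : ∀ j a as → p (suc j) (a ∷ as) ≡ + a + t * p j as - m * q j as
    p-cons j a as =
      trans (cong₂ (λ x y → x - c * y) (P-cons a as) (P-mulβ (powβ t m j)))
            (regroup (+ a) (P (E as)) (Q (E as)) (P (powβ t m j)) (Q (powβ t m j)))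
      where
      regroup : ∀ a x y x₀ y₀ →
                a + t * x - m * y - c * (t * x₀ - m * y₀) ≡ a + t * (x - c * x₀) - m * (y - c * y₀)
      regroup a x y x₀ y₀ = solve (a ∷ x ∷ y ∷ x₀ ∷ y₀ ∷ t ∷ m ∷ c ∷ [])

    q-cons : ∀ j a as → q (suc j) (a ∷ as) ≡ p j as
    q-cons j a as = cong (_- c * P (powβ t m j)) (Q-cons a as)

    q-[]-nonPos : ∀ j → q j [] ≤ + 0
    q-[]-nonPos j = subst (_≤ + 0) (sym (ℤP.+-identityˡ _))
                      (ℤP.neg-mono-≤ (*-nonNeg 0≤c (proj₁ (powβ-0≤2Q≤P j))))

    B : ℤ
    B = c + c + m * c

    Small : ℕ → List ℕ → Set
    Small j as = + length as ≤ + j + (c + c) × All (λ a → + a ≤ B) as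

    Small-cons : ∀ {j a as} → + a ≤ B → Small j as → Small (suc j) (a ∷ as)
    Small-cons {j} {a} {as} a≤B (l≤ , as≤B) =
      ℤP.≤-trans (ℤP.+-monoʳ-≤ (+ 1) l≤) (ℤP.≤-reflexive (sym (ℤP.+-assoc (+ 1) (+ j) (c + c)))) ,
      a≤B All.∷ as≤B

    c+c≤B : c + c ≤ B
    c+c≤B = i≤i+nonNeg (c + c) (*-nonNeg 0≤m 0≤c)

    P-c<Q⇒Q<c∧P≤c+c : ∀ {P Q} → Q + Q ≤ P → P - c < Q → Q < c × P ≤ c + c
    P-c<Q⇒Q<c∧P≤c+c {P} {Q} 2Q≤P P-c<Q = ℤP.suc[i]≤j⇒i<j 1+Q≤c , P≤2c
      where
      0≤Q-[1+P-c] : + 0 ≤ Q - (+ 1 + (P - c))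
      0≤Q-[1+P-c] = ℤP.i≤j⇒0≤j-i (ℤP.i<j⇒suc[i]≤j P-c<Q)
      1+Q≤c : + 1 + Q ≤ c
      1+Q≤c = ≤-by-gap 0≤gap₁ (solve (P ∷ Q ∷ c ∷ []))
        where
        0≤gap₁ : + 0 ≤ Q - (+ 1 + (P - c)) + (P - (Q + Q))
        0≤gap₁ = ℤP.+-mono-≤ 0≤Q-[1+P-c] (ℤP.i≤j⇒0≤j-i 2Q≤P)
      P≤2c : P ≤ c + c
      P≤2c = ≤-by-gap 0≤gap₂ (solve (P ∷ Q ∷ c ∷ []))
        where
        0≤gap₂ : + 0 ≤ Q - (+ 1 + (P - c)) + (c - (+ 1 + Q)) + + 2
        0≤gap₂ = ℤP.+-mono-≤ (ℤP.+-mono-≤ 0≤Q-[1+P-c] (ℤP.i≤j⇒0≤j-i 1+Q≤c)) (+≤+ z≤n)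

    digit≤B : ∀ {j a q′} → a ≤ m * q′ → q′ + + j < c → a ≤ B
    digit≤B {j} {a} {q′} a≤mq′ q′+j<c = begin
      a       ≤⟨ a≤mq′ ⟩
      m * q′  ≤⟨ ℤP.*-monoˡ-≤-nonNeg m {{nonNegative 0≤m}} q′≤c ⟩
      m * c   ≤⟨ ℤP.i≤j+i (m * c) (c + c) {{nonNegative (ℤP.+-mono-≤ 0≤c 0≤c)}} ⟩
      B       ∎
      where
      q′≤c : q′ ≤ c
      q′≤c = ℤP.<⇒≤ (ℤP.≤-<-trans (ℤP.i≤i+j q′ (+ j)) q′+j<c)

    0≤p<q⇒Small : ∀ j as → Trimmed as → + 0 ≤ p j as → p j as < q j as → q j as + + j < c × Small j as
    0≤p<q⇒Small zero as tr _ p<q with Trimmed⇒Bounded as tr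
    ... | _ , 2Q≤P , l≤P , as≤P =
      q+0<c , l≤2c , All.map (λ a≤P → ℤP.≤-trans a≤P (ℤP.≤-trans P≤2c c+c≤B)) as≤P
      where
      bounds : Q (E as) < c × P (E as) ≤ c + c
      bounds = P-c<Q⇒Q<c∧P≤c+c 2Q≤P (subst₂ _<_ (p-zero as) (q-zero as) p<q)
      P≤2c : P (E as) ≤ c + c
      P≤2c = proj₂ bounds
      q+0<c : q 0 as + + 0 < c
      q+0<c = begin-strict
        q 0 as + + 0  ≡⟨ ℤP.+-identityʳ (q 0 as) ⟩
        q 0 as        ≡⟨ q-zero as ⟩
        Q (E as)      <⟨ proj₁ bounds ⟩
        c             ∎
      l≤2c : + length as ≤ + 0 + (c + c)
      l≤2c = begin
        + length as   ≤⟨ l≤P ⟩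
        P (E as)      ≤⟨ P≤2c ⟩
        c + c         ≡⟨ ℤP.+-identityˡ (c + c) ⟨
        + 0 + (c + c) ∎
    0≤p<q⇒Small (suc j) [] _ 0≤p p<q =
      ⊥-elim (ℤP.<-irrefl refl (ℤP.<-≤-trans (ℤP.≤-<-trans 0≤p p<q) (q-[]-nonPos (suc j))))
    0≤p<q⇒Small (suc j) (a ∷ as) tr 0≤p p<q =
      let (q′+j<c , small) = 0≤p<q⇒Small j as (Trimmed-tail {a} {as} tr) 0≤p′ p′<q′
      in  ℤP.≤-<-trans q+1+j≤q′+j q′+j<c ,
          Small-cons (digit≤B (digit-step-≤m*q′ 0≤p′ a+tp′-mq′≤p′) q′+j<c) small
      where
      p′ q′ : ℤ
      p′ = p j as
      q′ = q j as
      0≤a+tp′-mq′ : + 0 ≤ + a + t * p′ - m * q′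
      0≤a+tp′-mq′ = subst (+ 0 ≤_) (p-cons j a as) 0≤p
      a+tp′-mq′<p′ : + a + t * p′ - m * q′ < p′
      a+tp′-mq′<p′ = subst₂ _<_ (p-cons j a as) (q-cons j a as) p<q
      a+tp′-mq′≤p′ : + a + t * p′ - m * q′ ≤ p′
      a+tp′-mq′≤p′ = ℤP.<⇒≤ a+tp′-mq′<p′
      0<p′ : + 0 < p′
      0<p′ = ℤP.≤-<-trans 0≤a+tp′-mq′ a+tp′-mq′<p′
      0≤p′ : + 0 ≤ p′
      0≤p′ = ℤP.<⇒≤ 0<p′
      p′<q′ : p′ < q′
      p′<q′ = digit-step-p′<q′ {+ a} 0≤p′ a+tp′-mq′≤p′
                (ℤP.≤-trans (ℤP.i<j⇒suc[i]≤j 0<p′) (ℤP.i≤j+i p′ (+ a)))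
      p′+1≤q′ : p′ + + 1 ≤ q′
      p′+1≤q′ = subst (_≤ q′) (ℤP.+-comm (+ 1) p′) (ℤP.i<j⇒suc[i]≤j p′<q′)
      q+1+j≤q′+j : q (suc j) (a ∷ as) + + suc j ≤ q′ + + j
      q+1+j≤q′+j = begin
        q (suc j) (a ∷ as) + + suc j  ≡⟨ cong (_+ + suc j) (q-cons j a as) ⟩
        p′ + (+ 1 + + j)              ≡⟨ ℤP.+-assoc p′ (+ 1) (+ j) ⟨
        p′ + + 1 + + j                ≤⟨ ℤP.+-monoˡ-≤ (+ j) p′+1≤q′ ⟩
        q′ + + j                      ∎

    record Expansion (j : ℕ) (as : List ℕ) : Set where
      constructor expansion
      field
        leading-nonzero : LeadingNonzero as
        p≡0             : p j as ≡ + 0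
        q≡0             : q j as ≡ + 0

    IsExpansion⇒Expansion : ∀ j as → IsExpansion t m (scale c (powβ t m j)) as → Expansion j as
    IsExpansion⇒Expansion j as (ln , Eas≡cβʲ) = expansion ln p≡0 q≡0
      where
      β^j = powβ t m j
      p≡0 : p j as ≡ + 0
      p≡0 = begin-equality
        P (E as) - c * P β^j             ≡⟨ cong (λ α → P α - c * P β^j) Eas≡cβʲ ⟩
        P (scale c β^j) - c * P β^j      ≡⟨ cong (_- c * P β^j) (P-scale c β^j) ⟩
        c * P β^j - c * P β^j            ≡⟨ ℤP.+-inverseʳ (c * P β^j) ⟩
        + 0                              ∎
      q≡0 : q j as ≡ + 0
      q≡0 = trans (cong (λ α → Q α - c * Q β^j) Eas≡cβʲ) (ℤP.+-inverseʳ (c * Q β^j))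

    Expansion-zero-digit : ∀ {j as} → Expansion (suc j) (0 ∷ as) → Expansion j as
    Expansion-zero-digit {j} {as} (expansion ln p≡0 q≡0) =
      expansion (LeadingNonzero-tail {as} ln) p′≡0 (m*q≡0⇒q≡0 m*q′≡0)
      where
      p′≡0 : p j as ≡ + 0
      p′≡0 = trans (sym (q-cons j 0 as)) q≡0
      negate : ∀ x y → m * y ≡ - (+ 0 + t * x - m * y) + t * x
      negate x y = solve (x ∷ y ∷ t ∷ m ∷ [])
      p₀≡0 : + 0 + t * p j as - m * q j as ≡ + 0
      p₀≡0 = trans (sym (p-cons j 0 as)) p≡0
      m*q′≡0 : m * q j as ≡ + 0
      m*q′≡0 = begin-equality
        m * q j as                                      ≡⟨ negate (p j as) (q j as) ⟩
        - (+ 0 + t * p j as - m * q j as) + t * p j as  ≡⟨ cong₂ (λ x y → - x + t * y) p₀≡0 p′≡0 ⟩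
        + 0 + t * + 0                                   ≡⟨ cong (_+_ (+ 0)) (ℤP.*-zeroʳ t) ⟩
        + 0                                             ∎

    Expansion-nonzero-digit : ∀ {j a as} → Expansion (suc j) (suc a ∷ as) →
                              + suc j < c × Small (suc j) (suc a ∷ as)
    Expansion-nonzero-digit {j} {a} {as} (expansion ln p≡0 q≡0) =
      let (q′+j<c , small) = 0≤p<q⇒Small j as (Trimmed-tail {suc a} {as} ln) 0≤p′ p′<q′
      in  ℤP.≤-<-trans 1+j≤q′+j q′+j<c ,
          Small-cons (digit≤B (digit-step-≤m*q′ 0≤p′ a+tp′-mq′≤p′) q′+j<c) small
      where
      p′ q′ : ℤ
      p′ = p j as
      q′ = q j as
      p′≡0 : p′ ≡ + 0
      p′≡0 = trans (sym (q-cons j (suc a) as)) q≡0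
      0≤p′ : + 0 ≤ p′
      0≤p′ = ℤP.≤-reflexive (sym p′≡0)
      a+tp′-mq′≤p′ : + suc a + t * p′ - m * q′ ≤ p′
      a+tp′-mq′≤p′ = ℤP.≤-reflexive (trans (sym (p-cons j (suc a) as)) (trans p≡0 (sym p′≡0)))
      p′<q′ : p′ < q′
      p′<q′ = digit-step-p′<q′ {+ suc a} 0≤p′ a+tp′-mq′≤p′
                (ℤP.≤-trans (+≤+ (s≤s z≤n)) (i≤i+nonNeg (+ suc a) 0≤p′))
      1+j≤q′+j : + suc j ≤ q′ + + j
      1+j≤q′+j = ℤP.+-monoˡ-≤ (+ j) (subst (λ x → + 1 + x ≤ q′) p′≡0 (ℤP.i<j⇒suc[i]≤j p′<q′))

    Expansion⇒Small : ∀ j as → Expansion j as → Small j as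
    Expansion⇒Small zero as (expansion ln p≡0 _) with Trimmed⇒Bounded as (LeadingNonzero⇒Trimmed {as} ln)
    ... | _ , _ , l≤P , as≤P = l≤2c , All.map (λ a≤P → ℤP.≤-trans a≤P (ℤP.≤-trans P≤c c≤B)) as≤P
      where
      P≤c : P (E as) ≤ c
      P≤c = ℤP.≤-reflexive (ℤP.i-j≡0⇒i≡j _ _ (trans (sym (p-zero as)) p≡0))
      c≤c+c : c ≤ c + c
      c≤c+c = i≤i+nonNeg c 0≤c
      c≤B : c ≤ B
      c≤B = ℤP.≤-trans c≤c+c c+c≤B
      l≤2c : + length as ≤ + 0 + (c + c)
      l≤2c = begin
        + length as    ≤⟨ l≤P ⟩
        P (E as)       ≤⟨ P≤c ⟩
        c              ≤⟨ c≤c+c ⟩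
        c + c          ≡⟨ ℤP.+-identityˡ (c + c) ⟨
        + 0 + (c + c)  ∎
    Expansion⇒Small (suc j) []           (expansion () _ _)
    Expansion⇒Small (suc j) (zero  ∷ as) ex =
      Small-cons (ℤP.≤-trans (ℤP.+-mono-≤ 0≤c 0≤c) c+c≤B) (Expansion⇒Small j as (Expansion-zero-digit ex))
    Expansion⇒Small (suc j) (suc a ∷ as) ex = proj₂ (Expansion-nonzero-digit ex)

    Expansion-leading-zero : ∀ {j as} → c ≤ + j → Expansion (suc j) as → ∃ λ as′ → as ≡ 0 ∷ as′ × Expansion j as′
    Expansion-leading-zero {as = []}          _   (expansion () _ _)
    Expansion-leading-zero {as = zero  ∷ as}  _   ex = as , refl , Expansion-zero-digit ex
    Expansion-leading-zero {j} {suc a ∷ as}   c≤j ex =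
      ⊥-elim (ℤP.<-irrefl refl (begin-strict
        c        ≤⟨ c≤j ⟩
        + j      <⟨ +<+ (ℕP.n<1+n j) ⟩
        + suc j  <⟨ proj₁ (Expansion-nonzero-digit ex) ⟩
        c        ∎))

module Counting (M T C : ℕ) (1≤M : 1 ℕ.≤ M) (2+M≤T : 2 ℕ.+ M ℕ.≤ T) where

  open Expansions (+ T) (+ M) (+≤+ 1≤M) (+≤+ 2+M≤T)
  open Multiples (+ C) (+≤+ z≤n)

  width digitBound : ℕ
  width      = C ℕ.+ (C ℕ.+ C)
  digitBound = C ℕ.+ C ℕ.+ M ℕ.* C

  candidates : ℕ → List (List ℕ)
  candidates n = map (replicate (n ∸ C) 0 ++_) (boundedLists width digitBound)

  Small⇒∈boundedLists : ∀ {n as} → n ℕ.≤ C → Small n as → as ∈ boundedLists width digitBound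
  Small⇒∈boundedLists {n} n≤C (l≤ , as≤B) =
    ∈-boundedLists (ℕP.≤-trans (ℤP.drop‿+≤+ l≤) (ℕP.+-monoˡ-≤ (C ℕ.+ C) n≤C))
                   (All.map (λ a≤B → ℤP.drop‿+≤+ (subst (_ ≤_) B≡digitBound a≤B)) as≤B)
    where
    B≡digitBound : B ≡ + digitBound
    B≡digitBound = cong (_+_ (+ (C ℕ.+ C))) (sym (ℤP.pos-* M C))

  Expansion-zero-prefix : ∀ k {as} → Expansion (k ℕ.+ C) as → ∃ λ as′ → as ≡ replicate k 0 ++ as′ × Expansion C as′
  Expansion-zero-prefix zero    ex = _ , refl , ex
  Expansion-zero-prefix (suc k) ex
    with as′ , refl , ex′ ← Expansion-leading-zero (+≤+ (ℕP.m≤n+m C k)) ex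
    with as″ , refl , ex″ ← Expansion-zero-prefix k ex′
    = as″ , refl , ex″

  Expansion⇒∈candidates : ∀ n {as} → Expansion n as → as ∈ candidates n
  Expansion⇒∈candidates n {as} ex with n ℕP.≤? C
  ... | yes n≤C rewrite ℕP.m≤n⇒m∸n≡0 n≤C = ∈-map⁺ ([] ++_) (Small⇒∈boundedLists n≤C (Expansion⇒Small n as ex))
  ... | no  n≰C =
    let (as′ , as≡0ᵏ++as′ , ex′) =
          Expansion-zero-prefix (n ∸ C) (subst (λ k → Expansion k as) (sym (ℕP.m∸n+n≡m C≤n)) ex)
    in  subst (_∈ candidates n) (sym as≡0ᵏ++as′)
          (∈-map⁺ (replicate (n ∸ C) 0 ++_) (Small⇒∈boundedLists ℕP.≤-refl (Expansion⇒Small C as′ ex′)))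
    where
    C≤n : C ℕ.≤ n
    C≤n = ℕP.<⇒≤ (ℕP.≰⇒> n≰C)

  pβ-bounded : ∀ n → pβ≤ (+ T) (+ M) (scale (+ C) (powβ (+ T) (+ M) n)) (length (boundedLists width digitBound))
  pβ-bounded n fs unique expansions = begin
    length fs                               ≤⟨ Unique⇒length≤ unique (All.map ∈candidates expansions) ⟩
    length (candidates n)                   ≡⟨ length-map _ (boundedLists width digitBound) ⟩
    length (boundedLists width digitBound)  ∎
    where
    open ℕP.≤-Reasoning
    ∈candidates : ∀ {as} → IsExpansion (+ T) (+ M) (scale (+ C) (powβ (+ T) (+ M) n)) as → as ∈ candidates n
    ∈candidates {as} = Expansion⇒∈candidates n ∘ IsExpansion⇒Expansion n as

x²-[m+1]x+m-reducible : ∀ m → ¬ Irreducible (+ 1 + m) m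
x²-[m+1]x+m-reducible m irr = irr (m - + 1) square
  where
  square : (m - + 1) * (m - + 1) ≡ (+ 1 + m) * (+ 1 + m) - + 4 * m
  square = solve (m ∷ [])

proposition11 : (t m : ℤ) → Irreducible t m → TotallyPositive t m → m < t →
    Σ ℕ (λ c → (0 Data.Nat.< c) × ((n : ℕ) → pβ≤ t m (scale t (powβ t m n)) c))
proposition11 (+ T) (+ M) irr (_ , _ , +<+ 0<M) (+<+ M<T) with ℕP.m≤n⇒m<n∨m≡n M<T
... | inj₂ refl  = ⊥-elim (x²-[m+1]x+m-reducible (+ M) irr)
... | inj₁ 2+M≤T =
  length (boundedLists width digitBound) , boundedLists-nonempty width digitBound , pβ-bounded
  where open Counting M T T 0<M 2+M≤T
proposition11 (+ _)    -[1+ _ ] _ (_ , _ , ()) _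
proposition11 -[1+ _ ] _        _ (_ , () , _) _
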